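{- Let $d\ge1$ and let $l<k$ be positive integers. For every nonempty $B\subseteq\mathcal{S}_l$ with $B_l^+\ne\mathcal{S}_l$, $$\frac{|B_l^+|}{|B_k^+|}<\frac{|\mathcal{S}_l|}{|\mathcal{S}_k|}=\frac{n_d(l)}{n_d(k)}.$$
   Context: For a positive integer $m$, $\mathcal{S}_m=\{a\in\mathbb{Z}_{\ge0}^d:1\le a_1+\dots+a_d\le m\}$ and $n_d(m)=|\mathcal{S}_m|=\binom{d+m}{m}-1$. For $d$-tuples, $b\preceq a$ means $b_i\le a_i$ for all $i$. For $T\subseteq\mathcal{S}_l$ and $l'\ge l$, $T_{l'}^+=\{a\in\mathcal{S}_{l'}:\exists b\in T\text{ with }b\preceq a\}$. -}

module Defs where

open import Data.Nat using (ℕ; zero; suc; _+_; _≤_; _≤?_; _<_)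
open import Data.Nat.Properties using (≤-refl)
open import Data.List using (List; []; _∷_; map; concatMap; upTo; filter; length)
open import Data.List.Relation.Unary.Any using (Any; any?)
open import Data.Vec using (Vec; []; _∷_)
import Data.Vec as Vec
open import Data.Vec.Relation.Binary.Pointwise.Inductive using (Pointwise)
import Data.Vec.Relation.Binary.Pointwise.Inductive as PW
open import Data.Product using (_×_)
open import Relation.Nullary.Decidable using (Dec; _×-dec_)

Tuple : ℕ → Set
Tuple d = Vec ℕ d

total : ∀ {d} → Tuple d → ℕ
total = Vec.sum

_⪯_ : ∀ {d} → Tuple d → Tuple d → Set
b ⪯ a = Pointwise _≤_ b a

_⪯?_ : ∀ {d} (b a : Tuple d) → Dec (b ⪯ a)
b ⪯? a = PW.decidable _≤?_ b a

InS : ∀ {d} → ℕ → Tuple d → Set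
InS m a = 1 ≤ total a × total a ≤ m

InS? : ∀ {d} (m : ℕ) (a : Tuple d) → Dec (InS m a)
InS? m a = (1 ≤? total a) ×-dec (total a ≤? m)

-- all tuples with every entry in {0,…,m} (a finite box containing S_m)
box : (d m : ℕ) → List (Tuple d)
box zero    m = [] ∷ []
box (suc d) m = concatMap (λ x → map (x ∷_) (box d m)) (upTo (suc m))

-- S_m as an explicit (duplicate-free) list
S : (d m : ℕ) → List (Tuple d)
S d m = filter (InS? m) (box d m)

Up : ∀ {d} → List (Tuple d) → Tuple d → Set
Up T a = Any (λ b → b ⪯ a) T

Up? : ∀ {d} (T : List (Tuple d)) (a : Tuple d) → Dec (Up T a)
Up? T a = any? (λ b → b ⪯? a) T

plus : ∀ {d} → List (Tuple d) → ℕ → List (Tuple d)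
plus {d} T l' = filter (Up? T) (S d l')

{-# OPTIONS --safe #-}
-- For the tuples of total j in ℕ^d let n j count all of them, u j those in B⁺ and x j = n j − u j
-- the others. The complement of B⁺ is down-closed, so it satisfies the LYM inequality
-- (j + 1) x (j + 1) ≤ (j + d) x j, proved by induction on d since a level of ℕ^(d+1) is a
-- convolution of levels of ℕ^d; the n j = C(d − 1 + j, j) satisfy it with equality. Hence x j / n j
-- is non-increasing, and strictly decreases somewhere between 1 and k because B⁺ is nonempty and
-- misses part of S_l. Averaging, (x 1 + ⋯ + x k) / (n 1 + ⋯ + n k) < (x 1 + ⋯ + x l) / (n 1 + ⋯ + n l),
-- which for u = n − x is the claim.

module Submission where

open import Data.Bool using (Bool; true; false; not; _∧_)
open import Data.Empty using (⊥-elim)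
open import Data.List using (List; []; _∷_; length; filter; map; concatMap; upTo; applyUpTo; _++_)
open import Data.List.Properties using (filter-all)
open import Data.List.Relation.Unary.All as All using (All; _∷_)
open import Data.List.Relation.Unary.Any as Any using (here)
open import Data.Nat
open import Data.Nat.Combinatorics using (_C_; nCn≡1; nC1≡n; nCk+nC[k+1]≡[n+1]C[k+1])
open import Data.Nat.Properties
open import Algebra.Properties.CommutativeSemigroup +-commutativeSemigroup using ()
  renaming (interchange to +-interchange)
open import Algebra.Properties.CommutativeSemigroup *-commutativeSemigroup
  using (x∙yz≈y∙xz; x∙yz≈yx∙z; xy∙z≈xz∙y; xy∙z≈y∙xz)
open import Data.Nat.Tactic.RingSolver using (solve-∀)
open import Data.Product using (∃-syntax; _×_; _,_)
open import Data.Unit using (tt)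
open import Data.Vec using ([]; _∷_; replicate)
import Data.Vec.Relation.Binary.Pointwise.Inductive as Pointwise
open import Function using (_∘_; id; const; _⇔_; mk⇔)
open import Relation.Binary.PropositionalEquality
open import Relation.Nullary using (¬_; yes; no; does; _×-dec_)
open import Relation.Nullary.Decidable using (dec-true; dec-false; does-⇔)
open import Relation.Unary using (Pred; Decidable)
open import Defs

-- Convolution

-- conv F j = Σ_{t + i = j} F t i
conv : (ℕ → ℕ → ℕ) → ℕ → ℕ
conv F zero    = F 0 0
conv F (suc j) = F 0 (suc j) + conv (F ∘ suc) j

conv-cong : ∀ {F G} → (∀ t i → F t i ≡ G t i) → ∀ j → conv F j ≡ conv G j
conv-cong F≡G zero    = F≡G 0 0
conv-cong F≡G (suc j) = cong₂ _+_ (F≡G 0 (suc j)) (conv-cong (F≡G ∘ suc) j)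

conv-mono-≤ : ∀ {F G} → (∀ t i → F t i ≤ G t i) → ∀ j → conv F j ≤ conv G j
conv-mono-≤ F≤G zero    = F≤G 0 0
conv-mono-≤ F≤G (suc j) = +-mono-≤ (F≤G 0 (suc j)) (conv-mono-≤ (F≤G ∘ suc) j)

conv-+ : ∀ F G j → conv (λ t i → F t i + G t i) j ≡ conv F j + conv G j
conv-+ F G zero    = refl
conv-+ F G (suc j) = trans (cong (F 0 (suc j) + G 0 (suc j) +_) (conv-+ (F ∘ suc) (G ∘ suc) j))
                           (+-interchange (F 0 (suc j)) (G 0 (suc j)) _ _)

conv-*ˡ : ∀ c F j → conv (λ t i → c * F t i) j ≡ c * conv F j
conv-*ˡ c F zero    = refl
conv-*ˡ c F (suc j) = trans (cong (c * F 0 (suc j) +_) (conv-*ˡ c (F ∘ suc) j))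
                            (sym (*-distribˡ-+ c (F 0 (suc j)) _))

conv-zero : ∀ j → conv (λ _ _ → 0) j ≡ 0
conv-zero zero    = refl
conv-zero (suc j) = conv-zero j

conv-weighted : ∀ F j → conv (λ t i → (t + i) * F t i) j ≡ j * conv F j
conv-weighted F zero    = refl
conv-weighted F (suc j) = begin
  suc j * F 0 (suc j) + conv (λ t i → (suc t + i) * F (suc t) i) j
    ≡⟨ cong (suc j * F 0 (suc j) +_) (conv-+ (F ∘ suc) (λ t i → (t + i) * F (suc t) i) j) ⟩
  suc j * F 0 (suc j) + (conv (F ∘ suc) j + conv (λ t i → (t + i) * F (suc t) i) j)
    ≡⟨ cong (λ z → suc j * F 0 (suc j) + (conv (F ∘ suc) j + z)) (conv-weighted (F ∘ suc) j) ⟩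
  suc j * F 0 (suc j) + suc j * conv (F ∘ suc) j
    ≡⟨ *-distribˡ-+ (suc j) (F 0 (suc j)) (conv (F ∘ suc) j) ⟨
  suc j * conv F (suc j) ∎
  where open ≡-Reasoning

conv-unfoldʳ : ∀ G j → conv G (suc j) ≡ G (suc j) 0 + conv (λ t i → G t (suc i)) j
conv-unfoldʳ G zero    = +-comm (G 0 1) (G 1 0)
conv-unfoldʳ G (suc j) = begin
  G 0 (2 + j) + conv (G ∘ suc) (suc j)
    ≡⟨ cong (G 0 (2 + j) +_) (conv-unfoldʳ (G ∘ suc) j) ⟩
  G 0 (2 + j) + (G (2 + j) 0 + conv (λ t i → G (suc t) (suc i)) j)
    ≡⟨ x+[y+z]≡y+[x+z] (G 0 (2 + j)) (G (2 + j) 0) _ ⟩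
  G (2 + j) 0 + conv (λ t i → G t (suc i)) (suc j) ∎
  where
  open ≡-Reasoning
  x+[y+z]≡y+[x+z] : ∀ x y z → x + (y + z) ≡ y + (x + z)
  x+[y+z]≡y+[x+z] = solve-∀

conv-≥ : ∀ F t i → F t i ≤ conv F (t + i)
conv-≥ F zero    zero    = ≤-refl
conv-≥ F zero    (suc i) = m≤m+n _ _
conv-≥ F (suc t) i       = ≤-trans (conv-≥ (F ∘ suc) t i) (m≤n+m _ _)

conv-witness : ∀ F j → conv F j ≢ 0 → ∃[ t ] ∃[ i ] t + i ≡ j × F t i ≢ 0
conv-witness F zero    conv≢0 = 0 , 0 , refl , conv≢0
conv-witness F (suc j) conv≢0 with F 0 (suc j) ≟ 0
... | no  F≢0 = 0 , suc j , refl , F≢0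
... | yes F≡0 with conv-witness (F ∘ suc) j (conv≢0 ∘ cong₂ _+_ F≡0)
... | t , i , t+i≡j , F≢0 = suc t , i , cong suc t+i≡j , F≢0

conv-first-row : ∀ F → (∀ t i → F (suc t) i ≡ 0) → ∀ j → conv F j ≡ F 0 j
conv-first-row F F≡0 zero    = refl
conv-first-row F F≡0 (suc j) =
  trans (cong (F 0 (suc j) +_) (trans (conv-cong F≡0 j) (conv-zero j))) (+-identityʳ _)

-- Split the weight t + i: the t-part is absorbed by F (suc t) ≤ F t, the i-part by the row hypothesis.
conv-lym : ∀ c F → (∀ t i → F (suc t) i ≤ F t i) →
           (∀ t i → suc i * F t (suc i) ≤ (i + c) * F t i) →
           ∀ j → suc j * conv F (suc j) ≤ (j + suc c) * conv F j
conv-lym c F F-antitone F-lym j = begin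
  suc j * conv F (suc j)
    ≡⟨ conv-weighted F (suc j) ⟨
  conv (λ t i → (t + i) * F t i) (suc j)
    ≡⟨ conv-cong (λ t i → *-distribʳ-+ (F t i) t i) (suc j) ⟩
  conv (λ t i → t * F t i + i * F t i) (suc j)
    ≡⟨ conv-+ (λ t i → t * F t i) (λ t i → i * F t i) (suc j) ⟩
  conv (λ t i → suc t * F (suc t) i) j + conv (λ t i → i * F t i) (suc j)
    ≡⟨ cong (conv (λ t i → suc t * F (suc t) i) j +_) (conv-unfoldʳ (λ t i → i * F t i) j) ⟩
  conv (λ t i → suc t * F (suc t) i) j + conv (λ t i → suc i * F t (suc i)) j
    ≤⟨ +-mono-≤ (conv-mono-≤ (λ t i → *-monoʳ-≤ (suc t) (F-antitone t i)) j)
                (conv-mono-≤ F-lym j) ⟩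
  conv (λ t i → suc t * F t i) j + conv (λ t i → (i + c) * F t i) j
    ≡⟨ conv-+ (λ t i → suc t * F t i) (λ t i → (i + c) * F t i) j ⟨
  conv (λ t i → suc t * F t i + (i + c) * F t i) j
    ≡⟨ conv-cong (λ t i → regroup t i c (F t i)) j ⟩
  conv (λ t i → (t + i) * F t i + suc c * F t i) j
    ≡⟨ conv-+ (λ t i → (t + i) * F t i) (λ t i → suc c * F t i) j ⟩
  conv (λ t i → (t + i) * F t i) j + conv (λ t i → suc c * F t i) j
    ≡⟨ cong₂ _+_ (conv-weighted F j) (conv-*ˡ (suc c) F j) ⟩
  j * conv F j + suc c * conv F j
    ≡⟨ *-distribʳ-+ (conv F j) j (suc c) ⟨
  (j + suc c) * conv F j ∎
  where
  open ≤-Reasoning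
  regroup : ∀ t i c x → suc t * x + (i + c) * x ≡ (t + i) * x + suc c * x
  regroup = solve-∀

Σ₀ : ℕ → (ℕ → ℕ) → ℕ
Σ₀ zero    f = f 0
Σ₀ (suc m) f = f 0 + Σ₀ m (f ∘ suc)

Σ₁ : ℕ → (ℕ → ℕ) → ℕ
Σ₁ zero    f = 0
Σ₁ (suc m) f = Σ₁ m f + f (suc m)

Σ₀-cong : ∀ {f g} → (∀ x → f x ≡ g x) → ∀ m → Σ₀ m f ≡ Σ₀ m g
Σ₀-cong f≡g zero    = f≡g 0
Σ₀-cong f≡g (suc m) = cong₂ _+_ (f≡g 0) (Σ₀-cong (f≡g ∘ suc) m)

Σ₀-zero : ∀ m → Σ₀ m (λ _ → 0) ≡ 0
Σ₀-zero zero    = refl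
Σ₀-zero (suc m) = Σ₀-zero m

Σ₀-+ : ∀ m f g → Σ₀ m (λ x → f x + g x) ≡ Σ₀ m f + Σ₀ m g
Σ₀-+ zero    f g = refl
Σ₀-+ (suc m) f g = trans (cong (f 0 + g 0 +_) (Σ₀-+ m (f ∘ suc) (g ∘ suc)))
                         (+-interchange (f 0) (g 0) _ _)

Σ₀-snoc : ∀ m f → Σ₀ (suc m) f ≡ Σ₀ m f + f (suc m)
Σ₀-snoc zero    f = refl
Σ₀-snoc (suc m) f = trans (cong (f 0 +_) (Σ₀-snoc m (f ∘ suc))) (sym (+-assoc (f 0) _ _))

Σ₀≡head+Σ₁ : ∀ m f → Σ₀ m f ≡ f 0 + Σ₁ m f
Σ₀≡head+Σ₁ zero    f = sym (+-identityʳ (f 0))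
Σ₀≡head+Σ₁ (suc m) f =
  trans (Σ₀-snoc m f) (trans (cong (_+ f (suc m)) (Σ₀≡head+Σ₁ m f)) (+-assoc (f 0) _ _))

Σ₁-cong : ∀ {f g} → (∀ x → f x ≡ g x) → ∀ m → Σ₁ m f ≡ Σ₁ m g
Σ₁-cong f≡g zero    = refl
Σ₁-cong f≡g (suc m) = cong₂ _+_ (Σ₁-cong f≡g m) (f≡g (suc m))

Σ₁-+ : ∀ m f g → Σ₁ m (λ x → f x + g x) ≡ Σ₁ m f + Σ₁ m g
Σ₁-+ zero    f g = refl
Σ₁-+ (suc m) f g = trans (cong (_+ (f (suc m) + g (suc m))) (Σ₁-+ m f g))
                         (+-interchange (Σ₁ m f) (Σ₁ m g) _ _)

Σ₁-*ˡ : ∀ c m f → Σ₁ m (λ x → c * f x) ≡ c * Σ₁ m f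
Σ₁-*ˡ c zero    f = sym (*-zeroʳ c)
Σ₁-*ˡ c (suc m) f = trans (cong (_+ c * f (suc m)) (Σ₁-*ˡ c m f))
                          (sym (*-distribˡ-+ c (Σ₁ m f) (f (suc m))))

Σ₁-*ʳ : ∀ c m f → Σ₁ m (λ x → f x * c) ≡ Σ₁ m f * c
Σ₁-*ʳ c zero    f = refl
Σ₁-*ʳ c (suc m) f = trans (cong (_+ f (suc m) * c) (Σ₁-*ʳ c m f))
                          (sym (*-distribʳ-+ c (Σ₁ m f) (f (suc m))))

Σ₁-mono-≤ : ∀ m {f g} → (∀ x → 1 ≤ x → x ≤ m → f x ≤ g x) → Σ₁ m f ≤ Σ₁ m g
Σ₁-mono-≤ zero    f≤g = ≤-refl
Σ₁-mono-≤ (suc m) f≤g =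
  +-mono-≤ (Σ₁-mono-≤ m (λ x 1≤x x≤m → f≤g x 1≤x (m≤n⇒m≤1+n x≤m)))
           (f≤g (suc m) (s≤s z≤n) ≤-refl)

Σ₁-mono-< : ∀ m {f g} → 1 ≤ m → (∀ x → 1 ≤ x → x ≤ m → f x ≤ g x) → f 1 < g 1 →
            Σ₁ m f < Σ₁ m g
Σ₁-mono-< (suc zero)    _ f≤g f1<g1 = f1<g1
Σ₁-mono-< (suc (suc m)) _ f≤g f1<g1 =
  +-mono-<-≤ (Σ₁-mono-< (suc m) (s≤s z≤n) (λ x 1≤x x≤m → f≤g x 1≤x (m≤n⇒m≤1+n x≤m)) f1<g1)
             (f≤g (2 + m) (s≤s z≤n) ≤-refl)

conv-const : ∀ f j → conv (λ _ → f) j ≡ Σ₀ j f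
conv-const f zero    = refl
conv-const f (suc j) =
  trans (cong (f (suc j) +_) (conv-const f j)) (trans (+-comm (f (suc j)) _) (sym (Σ₀-snoc j f)))

Σ₀-conv : ∀ F n → Σ₀ n (conv F) ≡ conv (λ t k → Σ₀ k (F t)) n
Σ₀-conv F zero    = refl
Σ₀-conv F (suc n) = begin
  F 0 0 + Σ₀ n (λ x → F 0 (suc x) + conv (F ∘ suc) x)
    ≡⟨ cong (F 0 0 +_) (Σ₀-+ n (F 0 ∘ suc) (conv (F ∘ suc))) ⟩
  F 0 0 + (Σ₀ n (F 0 ∘ suc) + Σ₀ n (conv (F ∘ suc)))
    ≡⟨ +-assoc (F 0 0) _ _ ⟨
  Σ₀ (suc n) (F 0) + Σ₀ n (conv (F ∘ suc))
    ≡⟨ cong (Σ₀ (suc n) (F 0) +_) (Σ₀-conv (F ∘ suc) n) ⟩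
  conv (λ t k → Σ₀ k (F t)) (suc n) ∎
  where open ≡-Reasoning

Σ₀-truncated : ∀ n m Φ H → n ≤ m →
               (∀ x → x ≤ n → Φ x ≡ H x (n ∸ x)) → (∀ x → n < x → Φ x ≡ 0) →
               Σ₀ m Φ ≡ conv H n
Σ₀-truncated zero zero Φ H _ low _ = low 0 z≤n
Σ₀-truncated zero (suc m) Φ H _ low high =
  trans (cong₂ _+_ (low 0 z≤n) (trans (Σ₀-cong (λ x → high (suc x) (s≤s z≤n)) m) (Σ₀-zero m)))
        (+-identityʳ _)
Σ₀-truncated (suc n) (suc m) Φ H (s≤s n≤m) low high =
  cong₂ _+_ (low 0 z≤n)
            (Σ₀-truncated n m (Φ ∘ suc) (H ∘ suc) n≤m
              (λ x x≤n → low (suc x) (s≤s x≤n)) (λ x n<x → high (suc x) (s≤s n<x)))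

hockey-stick : ∀ d m → Σ₀ m (λ j → (d + j) C j) ≡ (suc d + m) C m
hockey-stick d zero    = refl
hockey-stick d (suc m) = begin
  Σ₀ (suc m) (λ j → (d + j) C j)             ≡⟨ Σ₀-snoc m (λ j → (d + j) C j) ⟩
  Σ₀ m (λ j → (d + j) C j) + (d + suc m) C suc m
    ≡⟨ cong₂ _+_ (hockey-stick d m) (cong (_C suc m) (+-suc d m)) ⟩
  suc (d + m) C m + suc (d + m) C suc m      ≡⟨ nCk+nC[k+1]≡[n+1]C[k+1] (suc (d + m)) m ⟩
  suc (suc (d + m)) C suc m                  ≡⟨ cong (λ z → suc z C suc m) (+-suc d m) ⟨
  (suc d + suc m) C suc m                    ∎
  where open ≡-Reasoning

[1+k]*[1+n]C[1+k]≡[1+n]*nCk : ∀ n k → suc k * (suc n C suc k) ≡ suc n * (n C k)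
[1+k]*[1+n]C[1+k]≡[1+n]*nCk zero    zero    = refl
[1+k]*[1+n]C[1+k]≡[1+n]*nCk zero    (suc k) = *-zeroʳ (2 + k)
[1+k]*[1+n]C[1+k]≡[1+n]*nCk (suc n) zero    =
  trans (+-identityʳ _) (trans (nC1≡n (2 + n)) (sym (*-identityʳ (2 + n))))
[1+k]*[1+n]C[1+k]≡[1+n]*nCk (suc n) (suc k) = begin
  (2 + k) * ((2 + n) C (2 + k))
    ≡⟨ cong ((2 + k) *_) (nCk+nC[k+1]≡[n+1]C[k+1] (suc n) (suc k)) ⟨
  (2 + k) * (A + B)
    ≡⟨ *-distribˡ-+ (2 + k) A B ⟩
  (A + (1 + k) * A) + (2 + k) * B
    ≡⟨ cong₂ (λ y z → (A + y) + z) ([1+k]*[1+n]C[1+k]≡[1+n]*nCk n k)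
                                    ([1+k]*[1+n]C[1+k]≡[1+n]*nCk n (suc k)) ⟩
  (A + (1 + n) * (n C k)) + (1 + n) * (n C suc k)
    ≡⟨ +-assoc A _ _ ⟩
  A + ((1 + n) * (n C k) + (1 + n) * (n C suc k))
    ≡⟨ cong (A +_) (*-distribˡ-+ (suc n) (n C k) (n C suc k)) ⟨
  A + (1 + n) * (n C k + n C suc k)
    ≡⟨ cong (λ z → A + (1 + n) * z) (nCk+nC[k+1]≡[n+1]C[k+1] n k) ⟩
  (2 + n) * A ∎
  where
  open ≡-Reasoning
  A = suc n C suc k
  B = suc n C (2 + k)

nCk>0 : ∀ {n k} → k ≤ n → 0 < n C k
nCk>0 {n}     {zero}  _         = ≤-refl
nCk>0 {suc n} {suc k} (s≤s k≤n) =
  subst (0 <_) (nCk+nC[k+1]≡[n+1]C[k+1] n k) (≤-trans (nCk>0 k≤n) (m≤m+n _ _))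

-- Level counts

𝟙 : Bool → ℕ
𝟙 true  = 1
𝟙 false = 0

𝟙-mono : ∀ {b c} → (b ≡ true → c ≡ true) → 𝟙 b ≤ 𝟙 c
𝟙-mono {false}         _   = z≤n
𝟙-mono {true}  {true}  _   = ≤-refl
𝟙-mono {true}  {false} b⇒c with () ← b⇒c refl

slice : ∀ {d} → (Tuple (suc d) → Bool) → ℕ → Tuple d → Bool
slice g t a = g (t ∷ a)

-- level d g j is the number of a ∈ ℕ^d with total a ≡ j and g a ≡ true.
level : (d : ℕ) → (Tuple d → Bool) → ℕ → ℕ
level zero    g zero    = 𝟙 (g [])
level zero    g (suc j) = 0
level (suc d) g j       = conv (λ t → level d (slice g t)) j

level-mono : ∀ d {g h} → (∀ a → g a ≡ true → h a ≡ true) →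
             ∀ j → level d g j ≤ level d h j
level-mono zero    g⇒h zero    = 𝟙-mono (g⇒h [])
level-mono zero    g⇒h (suc j) = ≤-refl
level-mono (suc d) g⇒h j       = conv-mono-≤ (λ t → level-mono d (λ a → g⇒h (t ∷ a))) j

level-empty : ∀ d {g} → (∀ a → g a ≡ false) → ∀ j → level d g j ≡ 0
level-empty zero    g≡false zero    = cong 𝟙 (g≡false [])
level-empty zero    g≡false (suc j) = refl
level-empty (suc d) g≡false j       =
  trans (conv-cong (λ t → level-empty d (λ a → g≡false (t ∷ a))) j) (conv-zero j)

level-complement : ∀ d g j → level d (const true) j ≡ level d g j + level d (not ∘ g) j
level-complement zero    g zero    with g []
... | true  = refl
... | false = refl
level-complement zero    g (suc j) = refl
level-complement (suc d) g j       =
  trans (conv-cong (λ t → level-complement d (slice g t)) j)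
        (conv-+ (λ t → level d (slice g t)) (λ t → level d (not ∘ slice g t)) j)

level-origin : ∀ d g → level d g 0 ≡ 𝟙 (g (replicate d 0))
level-origin zero    g = refl
level-origin (suc d) g = level-origin d (slice g 0)

level-pos : ∀ d g (a : Tuple d) → g a ≡ true → 0 < level d g (total a)
level-pos zero    g []      ga rewrite ga = ≤-refl
level-pos (suc d) g (t ∷ a) ga =
  ≤-trans (level-pos d (slice g t) a ga) (conv-≥ (λ t → level d (slice g t)) t (total a))

level-witness : ∀ d g j → level d g j ≢ 0 → ∃[ a ] total a ≡ j × g a ≡ true
level-witness zero    g zero    level≢0 with g [] in ga
... | true  = [] , refl , ga
... | false = ⊥-elim (level≢0 refl)
level-witness zero    g (suc j) level≢0 = ⊥-elim (level≢0 refl)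
level-witness (suc d) g j       level≢0
  with conv-witness (λ t → level d (slice g t)) j level≢0
... | t , i , t+i≡j , sliceLevel≢0 with level-witness d (slice g t) i sliceLevel≢0
... | a , total≡i , ga = t ∷ a , trans (cong (t +_) total≡i) t+i≡j , ga

level-full : ∀ d j → level (suc d) (const true) j ≡ (d + j) C j
Σ₀-level-full : ∀ d m → Σ₀ m (level d (const true)) ≡ (d + m) C m

level-full d j = trans (conv-const (level d (const true)) j) (Σ₀-level-full d j)

Σ₀-level-full zero    zero    = refl
Σ₀-level-full zero    (suc m) = trans (cong suc (Σ₀-zero m)) (sym (nCn≡1 (suc m)))
Σ₀-level-full (suc d) m       = trans (Σ₀-cong (level-full d) m) (hockey-stick d m)

level-full-ratio : ∀ d j → suc j * level (suc d) (const true) (suc j)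
                           ≡ (j + suc d) * level (suc d) (const true) j
level-full-ratio d j = begin
  suc j * level (suc d) (const true) (suc j)  ≡⟨ cong (suc j *_) (level-full d (suc j)) ⟩
  suc j * ((d + suc j) C suc j)               ≡⟨ cong (λ z → suc j * (z C suc j)) (+-suc d j) ⟩
  suc j * (suc (d + j) C suc j)               ≡⟨ [1+k]*[1+n]C[1+k]≡[1+n]*nCk (d + j) j ⟩
  suc (d + j) * ((d + j) C j)
    ≡⟨ cong₂ _*_ (trans (+-suc j d) (cong suc (+-comm j d))) (level-full d j) ⟨
  (j + suc d) * level (suc d) (const true) j  ∎
  where open ≡-Reasoning

level-full-pos : ∀ d j → 0 < level (suc d) (const true) j
level-full-pos d j = subst (0 <_) (sym (level-full d j)) (nCk>0 (m≤n+m j d))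

-- The LYM inequality for down-closed sets

DownClosed : ∀ {d} → (Tuple d → Bool) → Set
DownClosed g = ∀ {a b} → b ⪯ a → g a ≡ true → g b ≡ true

downClosed-false : ∀ {d} {g : Tuple d → Bool} → DownClosed g →
                   ∀ {a b} → b ⪯ a → g b ≡ false → g a ≡ false
downClosed-false {g = g} g↓ {a} b⪯a gb≡false with g a in ga
... | false = refl
... | true with () ← trans (sym gb≡false) (g↓ b⪯a ga)

slice-downClosed : ∀ {d} {g : Tuple (suc d) → Bool} → DownClosed g →
                   ∀ t → DownClosed (slice g t)
slice-downClosed g↓ t b⪯a = g↓ (≤-refl Pointwise.∷ b⪯a)

slice-antitone : ∀ {d} {g : Tuple (suc d) → Bool} → DownClosed g →
                 ∀ t a → slice g (suc t) a ≡ true → slice g t a ≡ true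
slice-antitone g↓ t a = g↓ (n≤1+n t Pointwise.∷ Pointwise.refl ≤-refl)

level-lym : ∀ d g → DownClosed g → ∀ j → suc j * level d g (suc j) ≤ (j + d) * level d g j
level-lym zero    g g↓ j = ≤-trans (≤-reflexive (*-zeroʳ (suc j))) z≤n
level-lym (suc d) g g↓ j =
  conv-lym d (λ t → level d (slice g t))
    (λ t → level-mono d (slice-antitone g↓ t))
    (λ t → level-lym d (slice g t) (slice-downClosed g↓ t)) j

total≡0⇒⪯ : ∀ {d} {e : Tuple d} → total e ≡ 0 → ∀ a → e ⪯ a
total≡0⇒⪯ {e = []}       _       []      = Pointwise.[]
total≡0⇒⪯ {e = zero ∷ e} total≡0 (x ∷ a) = z≤n Pointwise.∷ total≡0⇒⪯ total≡0 a

-- If g misses the unit vector e, then g lies in the hyperplane t = 0 or every slice of g misses a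
-- unit vector; either way a dimension is lost, improving the factor j + d + 1 to j + d.
level-lym-strict : ∀ d g → DownClosed g → (e : Tuple (suc d)) → total e ≡ 1 → g e ≡ false →
                   ∀ j → suc j * level (suc d) g (suc j) ≤ (j + d) * level (suc d) g j
level-lym-strict d g g↓ (suc zero ∷ e) total≡1 ge≡false j =
  subst₂ (λ y z → suc j * y ≤ (j + d) * z)
         (sym (conv-first-row F F-first-row (suc j))) (sym (conv-first-row F F-first-row j))
         (level-lym d (slice g 0) (slice-downClosed g↓ 0) j)
  where
  F = λ t → level d (slice g t)
  F-first-row : ∀ t i → F (suc t) i ≡ 0
  F-first-row t = level-empty d (λ a →
    downClosed-false g↓ (s≤s z≤n Pointwise.∷ total≡0⇒⪯ (suc-injective total≡1) a) ge≡false)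
level-lym-strict zero    g g↓ (zero ∷ []) () _ j
level-lym-strict (suc d) g g↓ (zero ∷ e) total≡1 ge≡false j =
  conv-lym d (λ t → level (suc d) (slice g t))
    (λ t → level-mono (suc d) (slice-antitone g↓ t))
    (λ t → level-lym-strict d (slice g t) (slice-downClosed g↓ t) e total≡1 (missing t)) j
  where
  missing : ∀ t → g (t ∷ e) ≡ false
  missing t = downClosed-false g↓ (z≤n Pointwise.∷ Pointwise.refl ≤-refl) ge≡false

private variable X Y : Set

sumBy : (X → ℕ) → List X → ℕ
sumBy f []       = 0
sumBy f (x ∷ xs) = f x + sumBy f xs

sumBy-cong : ∀ {f g : X → ℕ} → (∀ a → f a ≡ g a) → ∀ xs → sumBy f xs ≡ sumBy g xs
sumBy-cong f≡g []       = refl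
sumBy-cong f≡g (x ∷ xs) = cong₂ _+_ (f≡g x) (sumBy-cong f≡g xs)

sumBy-zero : ∀ {f : X → ℕ} → (∀ a → f a ≡ 0) → ∀ xs → sumBy f xs ≡ 0
sumBy-zero f≡0 []       = refl
sumBy-zero f≡0 (x ∷ xs) = cong₂ _+_ (f≡0 x) (sumBy-zero f≡0 xs)

sumBy-+ : ∀ (f g : X → ℕ) xs → sumBy (λ a → f a + g a) xs ≡ sumBy f xs + sumBy g xs
sumBy-+ f g []       = refl
sumBy-+ f g (x ∷ xs) =
  trans (cong (f x + g x +_) (sumBy-+ f g xs)) (+-interchange (f x) (g x) _ _)

sumBy-++ : ∀ (f : X → ℕ) xs ys → sumBy f (xs ++ ys) ≡ sumBy f xs + sumBy f ys
sumBy-++ f []       ys = refl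
sumBy-++ f (x ∷ xs) ys = trans (cong (f x +_) (sumBy-++ f xs ys)) (sym (+-assoc (f x) _ _))

sumBy-map : ∀ (f : Y → ℕ) (h : X → Y) xs → sumBy f (map h xs) ≡ sumBy (f ∘ h) xs
sumBy-map f h []       = refl
sumBy-map f h (x ∷ xs) = cong (f (h x) +_) (sumBy-map f h xs)

sumBy-concatMap : ∀ (f : Y → ℕ) (h : X → List Y) xs →
                  sumBy f (concatMap h xs) ≡ sumBy (sumBy f ∘ h) xs
sumBy-concatMap f h []       = refl
sumBy-concatMap f h (x ∷ xs) =
  trans (sumBy-++ f (h x) (concatMap h xs)) (cong (sumBy f (h x) +_) (sumBy-concatMap f h xs))

length-filter-filter : ∀ {ℓ ℓ′} {P : Pred X ℓ} {Q : Pred X ℓ′} (P? : Decidable P) (Q? : Decidable Q) xs →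
  length (filter P? (filter Q? xs)) ≡ sumBy (λ a → 𝟙 (does (Q? a) ∧ does (P? a))) xs
length-filter-filter P? Q? [] = refl
length-filter-filter P? Q? (x ∷ xs) with does (Q? x)
... | false = length-filter-filter P? Q? xs
... | true with does (P? x)
...   | true  = cong suc (length-filter-filter P? Q? xs)
...   | false = length-filter-filter P? Q? xs

sumBy-applyUpTo : ∀ (f : ℕ → ℕ) h m → sumBy f (applyUpTo h (suc m)) ≡ Σ₀ m (f ∘ h)
sumBy-applyUpTo f h zero    = +-identityʳ _
sumBy-applyUpTo f h (suc m) = cong (f (h 0) +_) (sumBy-applyUpTo f (h ∘ suc) m)

-- The constraint x + |a| ≤ n on a tuple x ∷ a is |a| ≤ n ∸ x when x ≤ n, and unsatisfiable
-- otherwise.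
count-box : ∀ d m n g → n ≤ m →
            sumBy (λ a → 𝟙 (does (total a ≤? n) ∧ g a)) (box d m) ≡ Σ₀ n (level d g)
count-box zero    m zero    g _ = +-identityʳ _
count-box zero    m (suc n) g _ =
  trans (+-identityʳ _) (sym (trans (cong (𝟙 (g []) +_) (Σ₀-zero n)) (+-identityʳ _)))
count-box (suc d) m n       g n≤m = begin
  sumBy term (concatMap (λ x → map (x ∷_) (box d m)) (upTo (suc m)))
    ≡⟨ sumBy-concatMap term (λ x → map (x ∷_) (box d m)) (upTo (suc m)) ⟩
  sumBy (λ x → sumBy term (map (x ∷_) (box d m))) (upTo (suc m))
    ≡⟨ sumBy-applyUpTo (λ x → sumBy term (map (x ∷_) (box d m))) id m ⟩
  Σ₀ m (λ x → sumBy term (map (x ∷_) (box d m)))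
    ≡⟨ Σ₀-truncated n m _ (λ x k → Σ₀ k (level d (slice g x))) n≤m within beyond ⟩
  conv (λ x k → Σ₀ k (level d (slice g x))) n
    ≡⟨ Σ₀-conv (λ t → level d (slice g t)) n ⟨
  Σ₀ n (level (suc d) g) ∎
  where
  open ≡-Reasoning
  term : Tuple (suc d) → ℕ
  term a = 𝟙 (does (total a ≤? n) ∧ g a)
  within : ∀ x → x ≤ n → sumBy term (map (x ∷_) (box d m)) ≡ Σ₀ (n ∸ x) (level d (slice g x))
  within x x≤n = trans (sumBy-map term (x ∷_) (box d m))
    (trans (sumBy-cong (λ a → cong (λ b → 𝟙 (b ∧ g (x ∷ a))) (shift-does a)) (box d m))
           (count-box d m (n ∸ x) (slice g x) (≤-trans (m∸n≤m n x) n≤m)))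
    where
    shift : ∀ a → (x + total a ≤ n) ⇔ (total a ≤ n ∸ x)
    shift a = mk⇔ (λ x+t≤n → subst (_≤ n ∸ x) (m+n∸m≡n x (total a)) (∸-monoˡ-≤ x x+t≤n))
                  (λ t≤n∸x → subst (x + total a ≤_) (m+[n∸m]≡n x≤n) (+-monoʳ-≤ x t≤n∸x))
    shift-does : ∀ a → does (x + total a ≤? n) ≡ does (total a ≤? n ∸ x)
    shift-does a = does-⇔ (shift a) (x + total a ≤? n) (total a ≤? n ∸ x)
  beyond : ∀ x → n < x → sumBy term (map (x ∷_) (box d m)) ≡ 0
  beyond x n<x = trans (sumBy-map term (x ∷_) (box d m))
    (sumBy-zero (λ a → cong (λ b → 𝟙 (b ∧ g (x ∷ a))) (dec-false (x + total a ≤? n) (too-big a)))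
                (box d m))
    where
    too-big : ∀ a → ¬ x + total a ≤ n
    too-big a x+t≤n = <⇒≱ n<x (≤-trans (m≤m+n x (total a)) x+t≤n)

𝟙-InS-split : ∀ t m b → 𝟙 (does ((1 ≤? t) ×-dec (t ≤? m)) ∧ b) + 𝟙 (does (t ≤? 0) ∧ b)
                        ≡ 𝟙 (does (t ≤? m) ∧ b)
𝟙-InS-split zero    m b = refl
𝟙-InS-split (suc t) m b = +-identityʳ _

length-filter-S : ∀ {d ℓ} {P : Pred (Tuple d) ℓ} (P? : Decidable P) m →
                  length (filter P? (S d m)) ≡ Σ₁ m (level d (λ a → does (P? a)))
length-filter-S {d} P? m = +-cancelʳ-≡ (level d p 0) _ _ (begin
  length (filter P? (filter (InS? m) (box d m))) + level d p 0
    ≡⟨ cong₂ _+_ (length-filter-filter P? (InS? m) (box d m)) (sym (count-box d m 0 p z≤n)) ⟩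
  sumBy (λ a → 𝟙 (does (InS? m a) ∧ p a)) (box d m)
    + sumBy (λ a → 𝟙 (does (total a ≤? 0) ∧ p a)) (box d m)
    ≡⟨ sumBy-+ _ _ (box d m) ⟨
  sumBy (λ a → 𝟙 (does (InS? m a) ∧ p a) + 𝟙 (does (total a ≤? 0) ∧ p a)) (box d m)
    ≡⟨ sumBy-cong (λ a → 𝟙-InS-split (total a) m (p a)) (box d m) ⟩
  sumBy (λ a → 𝟙 (does (total a ≤? m) ∧ p a)) (box d m)
    ≡⟨ count-box d m m p ≤-refl ⟩
  Σ₀ m (level d p)
    ≡⟨ Σ₀≡head+Σ₁ m (level d p) ⟩
  level d p 0 + Σ₁ m (level d p)
    ≡⟨ +-comm (level d p 0) _ ⟩
  Σ₁ m (level d p) + level d p 0 ∎)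
  where
  open ≡-Reasoning
  p = λ a → does (P? a)

length-S : ∀ d m → length (S d m) ≡ Σ₁ m (level d (const true))
length-S d m =
  trans (cong length (sym (filter-all (λ _ → yes tt) (All.universal (λ _ → tt) (S d m)))))
        (length-filter-S {d} (λ _ → yes tt) m)

length-S-binomial : ∀ d m → length (S d m) ≡ ((d + m) C m) ∸ 1
length-S-binomial d m = begin
  length (S d m)     ≡⟨ length-S d m ⟩
  Σ₁ m full          ≡⟨ cong (_∸ 1) Σ₀≡1+Σ₁ ⟨
  Σ₀ m full ∸ 1      ≡⟨ cong (_∸ 1) (Σ₀-level-full d m) ⟩
  (d + m) C m ∸ 1    ∎
  where
  open ≡-Reasoning
  full = level d (const true)
  Σ₀≡1+Σ₁ : Σ₀ m full ≡ 1 + Σ₁ m full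
  Σ₀≡1+Σ₁ = trans (Σ₀≡head+Σ₁ m full) (cong (_+ Σ₁ m full) (level-origin d (const true)))

ratio-step : ∀ {a c x₀ x₁ n₀ n₁} → 0 < a →
             a * x₁ ≤ c * x₀ → a * n₁ ≡ c * n₀ → x₁ * n₀ ≤ x₀ * n₁
ratio-step {a} {c} {x₀} {x₁} {n₀} {n₁} a>0 ax₁≤cx₀ an₁≡cn₀ =
  *-cancelˡ-≤ a {{>-nonZero a>0}} (begin
  a * (x₁ * n₀)   ≡⟨ *-assoc a x₁ n₀ ⟨
  (a * x₁) * n₀   ≤⟨ *-monoˡ-≤ n₀ ax₁≤cx₀ ⟩
  (c * x₀) * n₀   ≡⟨ xy∙z≈y∙xz c x₀ n₀ ⟩
  x₀ * (c * n₀)   ≡⟨ cong (x₀ *_) an₁≡cn₀ ⟨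
  x₀ * (a * n₁)   ≡⟨ x∙yz≈y∙xz x₀ a n₁ ⟩
  a * (x₀ * n₁)   ∎)
  where open ≤-Reasoning

ratio-step-strict : ∀ {a c x₀ x₁ n₀ n₁} → 0 < a → 0 < x₀ → 0 < n₀ →
                    a * x₁ ≤ c * x₀ → a * n₁ ≡ suc c * n₀ → x₁ * n₀ < x₀ * n₁
ratio-step-strict {a} {c} {x₀} {x₁} {n₀} {n₁} a>0 x₀>0 n₀>0 ax₁≤cx₀ an₁≡cn₀ =
  *-cancelˡ-< a _ _ (begin-strict
  a * (x₁ * n₀)            ≡⟨ *-assoc a x₁ n₀ ⟨
  (a * x₁) * n₀            ≤⟨ *-monoˡ-≤ n₀ ax₁≤cx₀ ⟩
  (c * x₀) * n₀            <⟨ m<m+n _ (*-mono-≤ x₀>0 n₀>0) ⟩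
  (c * x₀) * n₀ + x₀ * n₀  ≡⟨ regroup c x₀ n₀ ⟩
  x₀ * (suc c * n₀)        ≡⟨ cong (x₀ *_) an₁≡cn₀ ⟨
  x₀ * (a * n₁)            ≡⟨ x∙yz≈y∙xz x₀ a n₁ ⟩
  a * (x₀ * n₁)            ∎)
  where
  open ≤-Reasoning
  regroup : ∀ c x m → (c * x) * m + x * m ≡ x * (suc c * m)
  regroup = solve-∀

complement-ratio : ∀ uₗ xₗ uₖ xₖ → xₖ * (uₗ + xₗ) < xₗ * (uₖ + xₖ) →
                   uₗ * (uₖ + xₖ) < (uₗ + xₗ) * uₖ
complement-ratio uₗ xₗ uₖ xₖ x-ratio = +-cancelʳ-< (xₗ * (uₖ + xₖ)) _ _ (begin-strict
  uₗ * (uₖ + xₖ) + xₗ * (uₖ + xₖ)  ≡⟨ regroup uₗ xₗ uₖ xₖ ⟩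
  (uₗ + xₗ) * uₖ + xₖ * (uₗ + xₗ)  <⟨ +-monoʳ-< ((uₗ + xₗ) * uₖ) x-ratio ⟩
  (uₗ + xₗ) * uₖ + xₗ * (uₖ + xₖ)  ∎)
  where
  open ≤-Reasoning
  regroup : ∀ a b c d → a * (c + d) + b * (c + d) ≡ (a + b) * c + d * (a + b)
  regroup = solve-∀

module Ratios (x n : ℕ → ℕ) (n>0 : ∀ j → 0 < n j) where

  -- j ≤ʳ i says x j / n j ≤ x i / n i.
  _≤ʳ_ _<ʳ_ : ℕ → ℕ → Set
  j ≤ʳ i = x j * n i ≤ x i * n j
  j <ʳ i = x j * n i < x i * n j

  private instance
    n≢0 : ∀ {j} → NonZero (n j)
    n≢0 {j} = >-nonZero (n>0 j)

  ≤ʳ-trans : ∀ {i j k} → k ≤ʳ j → j ≤ʳ i → k ≤ʳ i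
  ≤ʳ-trans {i} {j} {k} k≤j j≤i = *-cancelˡ-≤ (n j) (begin
    n j * (x k * n i)  ≡⟨ x∙yz≈yx∙z (n j) (x k) (n i) ⟩
    (x k * n j) * n i  ≤⟨ *-monoˡ-≤ (n i) k≤j ⟩
    (x j * n k) * n i  ≡⟨ xy∙z≈xz∙y (x j) (n k) (n i) ⟩
    (x j * n i) * n k  ≤⟨ *-monoˡ-≤ (n k) j≤i ⟩
    (x i * n j) * n k  ≡⟨ xy∙z≈y∙xz (x i) (n j) (n k) ⟩
    n j * (x i * n k)  ∎)
    where open ≤-Reasoning

  <ʳ-≤ʳ-trans : ∀ {i j k} → k <ʳ j → j ≤ʳ i → k <ʳ i
  <ʳ-≤ʳ-trans {i} {j} {k} k<j j≤i = *-cancelˡ-< (n j) _ _ (begin-strict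
    n j * (x k * n i)  ≡⟨ x∙yz≈yx∙z (n j) (x k) (n i) ⟩
    (x k * n j) * n i  <⟨ *-monoˡ-< (n i) k<j ⟩
    (x j * n k) * n i  ≡⟨ xy∙z≈xz∙y (x j) (n k) (n i) ⟩
    (x j * n i) * n k  ≤⟨ *-monoˡ-≤ (n k) j≤i ⟩
    (x i * n j) * n k  ≡⟨ xy∙z≈y∙xz (x i) (n j) (n k) ⟩
    n j * (x i * n k)  ∎)
    where open ≤-Reasoning

  ≤ʳ-<ʳ-trans : ∀ {i j k} → k ≤ʳ j → j <ʳ i → k <ʳ i
  ≤ʳ-<ʳ-trans {i} {j} {k} k≤j j<i = *-cancelˡ-< (n j) _ _ (begin-strict
    n j * (x k * n i)  ≡⟨ x∙yz≈yx∙z (n j) (x k) (n i) ⟩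
    (x k * n j) * n i  ≤⟨ *-monoˡ-≤ (n i) k≤j ⟩
    (x j * n k) * n i  ≡⟨ xy∙z≈xz∙y (x j) (n k) (n i) ⟩
    (x j * n i) * n k  <⟨ *-monoˡ-< (n k) j<i ⟩
    (x i * n j) * n k  ≡⟨ xy∙z≈y∙xz (x i) (n j) (n k) ⟩
    n j * (x i * n k)  ∎)
    where open ≤-Reasoning

  ≤ʳ-pos : ∀ {i j} → j ≤ʳ i → 0 < x j → 0 < x i
  ≤ʳ-pos {i} {j} j≤i xj>0 =
    n≢0⇒n>0 (λ xi≡0 → <⇒≢ (≤-trans (*-mono-≤ xj>0 (n>0 i)) j≤i) (sym (cong (_* n j) xi≡0)))

  module Antitone (step : ∀ j → suc j ≤ʳ j) where

    antitone′ : ∀ {i j} → i ≤′ j → j ≤ʳ i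
    antitone′ ≤′-refl        = ≤-refl
    antitone′ (≤′-step i≤′j) = ≤ʳ-trans (step _) (antitone′ i≤′j)

    antitone : ∀ {i j} → i ≤ j → j ≤ʳ i
    antitone = antitone′ ∘ ≤⇒≤′

    antitone-strict : ∀ {i s j} → i ≤ s → suc s ≤ j → suc s <ʳ s → j <ʳ i
    antitone-strict i≤s s<j s<ʳs =
      ≤ʳ-<ʳ-trans (antitone s<j) (<ʳ-≤ʳ-trans s<ʳs (antitone i≤s))

    partial-sums-<ʳ : ∀ {l k} → 1 ≤ l → l < k → k <ʳ 1 →
                      Σ₁ k x * Σ₁ l n < Σ₁ l x * Σ₁ k n
    partial-sums-<ʳ {l} {suc k} 1≤l (s≤s l≤k) k<ʳ1 = begin-strict
      (Σ₁ k x + x (suc k)) * Σ₁ l n         ≡⟨ *-distribʳ-+ (Σ₁ l n) (Σ₁ k x) _ ⟩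
      Σ₁ k x * Σ₁ l n + x (suc k) * Σ₁ l n  <⟨ +-mono-≤-< (partial-sums-≤ʳ (≤⇒≤′ l≤k)) last-level ⟩
      Σ₁ l x * Σ₁ k n + Σ₁ l x * n (suc k)  ≡⟨ *-distribˡ-+ (Σ₁ l x) (Σ₁ k n) _ ⟨
      Σ₁ l x * (Σ₁ k n + n (suc k))         ∎
      where
      open ≤-Reasoning
      level-≤ : ∀ {j} → l ≤ j → x j * Σ₁ l n ≤ Σ₁ l x * n j
      level-≤ {j} l≤j = begin
        x j * Σ₁ l n             ≡⟨ Σ₁-*ˡ (x j) l n ⟨
        Σ₁ l (λ i → x j * n i)   ≤⟨ Σ₁-mono-≤ l (λ i _ i≤l → antitone (≤-trans i≤l l≤j)) ⟩
        Σ₁ l (λ i → x i * n j)   ≡⟨ Σ₁-*ʳ (n j) l x ⟩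
        Σ₁ l x * n j             ∎
      last-level : x (suc k) * Σ₁ l n < Σ₁ l x * n (suc k)
      last-level = begin-strict
        x (suc k) * Σ₁ l n            ≡⟨ Σ₁-*ˡ (x (suc k)) l n ⟨
        Σ₁ l (λ i → x (suc k) * n i)
          <⟨ Σ₁-mono-< l 1≤l (λ i _ i≤l → antitone (≤-trans i≤l (m≤n⇒m≤1+n l≤k))) k<ʳ1 ⟩
        Σ₁ l (λ i → x i * n (suc k))  ≡⟨ Σ₁-*ʳ (n (suc k)) l x ⟩
        Σ₁ l x * n (suc k)            ∎
      partial-sums-≤ʳ : ∀ {j} → l ≤′ j → Σ₁ j x * Σ₁ l n ≤ Σ₁ l x * Σ₁ j n
      partial-sums-≤ʳ ≤′-refl = ≤-refl
      partial-sums-≤ʳ {suc j} (≤′-step l≤′j) = begin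
        (Σ₁ j x + x (suc j)) * Σ₁ l n          ≡⟨ *-distribʳ-+ (Σ₁ l n) (Σ₁ j x) _ ⟩
        Σ₁ j x * Σ₁ l n + x (suc j) * Σ₁ l n
          ≤⟨ +-mono-≤ (partial-sums-≤ʳ l≤′j) (level-≤ (m≤n⇒m≤1+n (≤′⇒≤ l≤′j))) ⟩
        Σ₁ l x * Σ₁ j n + Σ₁ l x * n (suc j)   ≡⟨ *-distribˡ-+ (Σ₁ l x) (Σ₁ j n) _ ⟨
        Σ₁ l x * (Σ₁ j n + n (suc j))          ∎

first-rise : ∀ (f : ℕ → ℕ) {i r} → i ≤′ r → f i ≡ 0 → 0 < f r →
             ∃[ s ] i ≤ s × s < r × f s ≡ 0 × 0 < f (suc s)
first-rise f ≤′-refl fi≡0 fr>0 = ⊥-elim (<⇒≢ fr>0 (sym fi≡0))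
first-rise f {r = suc r} (≤′-step i≤′r) fi≡0 fr>0 with f r ≟ 0
... | yes fr≡0 = r , ≤′⇒≤ i≤′r , ≤-refl , fr≡0 , fr>0
... | no  fr≢0 with first-rise f i≤′r fi≡0 (n≢0⇒n>0 fr≢0)
... | s , i≤s , s<r , fs≡0 , fs+1>0 = s , i≤s , m≤n⇒m≤1+n s<r , fs≡0 , fs+1>0

-- The up-set B⁺ generated by B

module UpSet {d} (B : List (Tuple (suc d))) where

  inUp : Tuple (suc d) → Bool
  inUp a = does (Up? B a)

  n u x : ℕ → ℕ
  n = level (suc d) (const true)
  u = level (suc d) inUp
  x = level (suc d) (not ∘ inUp)

  up-closed : ∀ {a b} → b ⪯ a → Up B b → Up B a
  up-closed b⪯a = Any.map (λ c⪯b → Pointwise.trans ≤-trans c⪯b b⪯a)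

  outside-downClosed : DownClosed (not ∘ inUp)
  outside-downClosed {a} {b} b⪯a a∉ with Up? B a | Up? B b
  ... | no a∉B | yes b∈B = ⊥-elim (a∉B (up-closed b⪯a b∈B))
  ... | no _   | no _    = refl

  n≡u+x : ∀ j → n j ≡ u j + x j
  n≡u+x = level-complement (suc d) inUp

  Σ₁n≡Σ₁u+Σ₁x : ∀ m → Σ₁ m n ≡ Σ₁ m u + Σ₁ m x
  Σ₁n≡Σ₁u+Σ₁x m = trans (Σ₁-cong n≡u+x m) (Σ₁-+ m u x)

  open Ratios x n (level-full-pos d)

  x-step : ∀ j → suc j ≤ʳ j
  x-step j = ratio-step {suc j} {j + suc d} {x j} {x (suc j)} {n j} {n (suc j)} (s≤s z≤n)
               (level-lym (suc d) (not ∘ inUp) outside-downClosed j) (level-full-ratio d j)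

  open Antitone x-step

  x-step-strict : ∀ {e} → total e ≡ 1 → inUp e ≡ true → ∀ j → 0 < x j → suc j <ʳ j
  x-step-strict {e} total≡1 e∈B⁺ j xj>0 =
    ratio-step-strict {suc j} {j + d} {x j} {x (suc j)} {n j} {n (suc j)}
      (s≤s z≤n) xj>0 (level-full-pos d j)
      (level-lym-strict d (not ∘ inUp) outside-downClosed e total≡1 (cong not e∈B⁺) j)
      (trans (level-full-ratio d j) (cong (_* n j) (+-suc j d)))

  rise-step : ∀ {s} → u s ≡ 0 → 0 < u (suc s) → suc s <ʳ s
  rise-step {s} us≡0 us+1>0 = begin-strict
    x (suc s) * n s  <⟨ *-monoˡ-< (n s) {{>-nonZero (level-full-pos d s)}} x<n ⟩
    n (suc s) * n s  ≡⟨ *-comm (n (suc s)) (n s) ⟩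
    n s * n (suc s)  ≡⟨ cong (_* n (suc s)) (trans (n≡u+x s) (cong (_+ x s) us≡0)) ⟩
    x s * n (suc s)  ∎
    where
    open ≤-Reasoning
    x<n : x (suc s) < n (suc s)
    x<n = subst (x (suc s) <_) (sym (n≡u+x (suc s))) (m<n+m (x (suc s)) us+1>0)

  x1>0 : ∀ {l} → ¬ (∀ a → InS l a → Up B a) → 0 < x 1
  x1>0 {l} B⁺≢Sₗ with x 1 ≟ 0
  ... | no  x1≢0 = n≢0⇒n>0 x1≢0
  ... | yes x1≡0 = ⊥-elim (B⁺≢Sₗ covered)
    where
    covered : ∀ a → InS l a → Up B a
    covered a (1≤|a| , _) with Up? B a
    ... | yes a∈B⁺ = a∈B⁺
    ... | no  a∉B⁺ =
      ⊥-elim (<⇒≢ (≤ʳ-pos {1} {total a} (antitone 1≤|a|) a-counted) (sym x1≡0))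
      where
      a-counted : 0 < x (total a)
      a-counted = level-pos (suc d) (not ∘ inUp) a (cong not (dec-false (Up? B a) a∉B⁺))

  -- Either B⁺ contains a unit vector, and the LYM step at level 1 is strict, or the level counts
  -- of B⁺ rise from 0 somewhere below |b| ≤ l, and the ratio drops from 1 there.
  strict-step : ∀ {l k b} → Up B b → InS l b → l < k → ¬ (∀ a → InS l a → Up B a) →
                ∃[ s ] 1 ≤ s × suc s ≤ k × suc s <ʳ s
  strict-step {l} {k} {b} b∈B⁺ (1≤|b| , |b|≤l) l<k B⁺≢Sₗ with u 1 ≟ 0
  ... | no u1≢0 with level-witness (suc d) inUp 1 u1≢0
  ...   | e , total≡1 , e∈B⁺ =
          1 , ≤-refl , ≤-trans (s≤s 1≤|b|) (≤-trans (s≤s |b|≤l) l<k) ,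
          x-step-strict {e} total≡1 e∈B⁺ 1 (x1>0 B⁺≢Sₗ)
  strict-step {l} {k} {b} b∈B⁺ (1≤|b| , |b|≤l) l<k B⁺≢Sₗ | yes u1≡0
    with first-rise u (≤⇒≤′ 1≤|b|) u1≡0 (level-pos (suc d) inUp b (dec-true (Up? B b) b∈B⁺))
  ... | s , 1≤s , s<|b| , us≡0 , us+1>0 =
          s , 1≤s , ≤-trans s<|b| (≤-trans |b|≤l (<⇒≤ l<k)) , rise-step {s} us≡0 us+1>0

  plus-ratio : ∀ {l k b} → 1 ≤ l → l < k → Up B b → InS l b → ¬ (∀ a → InS l a → Up B a) →
               length (plus B l) * length (S (suc d) k) < length (S (suc d) l) * length (plus B k)
  plus-ratio {l} {k} 1≤l l<k b∈B⁺ b∈Sₗ B⁺≢Sₗ with strict-step b∈B⁺ b∈Sₗ l<k B⁺≢Sₗ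
  ... | s , 1≤s , s<k , s-strict = begin-strict
    length (plus B l) * length (S (suc d) k)  ≡⟨ cong₂ _*_ (length-filter-S (Up? B) l) (length-S-split k) ⟩
    Σ₁ l u * (Σ₁ k u + Σ₁ k x)                <⟨ complement-ratio (Σ₁ l u) (Σ₁ l x) (Σ₁ k u) (Σ₁ k x) x-ratio ⟩
    (Σ₁ l u + Σ₁ l x) * Σ₁ k u                ≡⟨ cong₂ _*_ (length-S-split l) (length-filter-S (Up? B) k) ⟨
    length (S (suc d) l) * length (plus B k)  ∎
    where
    open ≤-Reasoning
    length-S-split : ∀ m → length (S (suc d) m) ≡ Σ₁ m u + Σ₁ m x
    length-S-split m = trans (length-S (suc d) m) (Σ₁n≡Σ₁u+Σ₁x m)
    x-ratio : Σ₁ k x * (Σ₁ l u + Σ₁ l x) < Σ₁ l x * (Σ₁ k u + Σ₁ k x)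
    x-ratio = subst₂ _<_ (cong (Σ₁ k x *_) (Σ₁n≡Σ₁u+Σ₁x l)) (cong (Σ₁ l x *_) (Σ₁n≡Σ₁u+Σ₁x k))
                         (partial-sums-<ʳ 1≤l l<k (antitone-strict 1≤s s<k s-strict))

lemma10p7 : (d l k : ℕ) → 1 ≤ d → 1 ≤ l → l < k →
    (B : List (Tuple d)) → All (InS l) B → B ≢ [] →
    ¬ (∀ (a : Tuple d) → InS l a → Up B a) →
    (length (plus B l) * length (S d k) < length (S d l) * length (plus B k))
    × (length (S d l) ≡ ((d + l) C l) ∸ 1)
    × (length (S d k) ≡ ((d + k) C k) ∸ 1)
lemma10p7 zero    l k ()
lemma10p7 (suc d) l k _ 1≤l l<k []      _          B≢[] _     = ⊥-elim (B≢[] refl)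
lemma10p7 (suc d) l k _ 1≤l l<k (b ∷ B) (b∈Sₗ ∷ _) _    B⁺≢Sₗ =
  UpSet.plus-ratio (b ∷ B) 1≤l l<k (here (Pointwise.refl ≤-refl)) b∈Sₗ B⁺≢Sₗ ,
  length-S-binomial (suc d) l ,
  length-S-binomial (suc d) k
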